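{- Every extensional $\mathbf{BCI}$-algebra, with $a^\bullet:=\mathbf{C}\,\mathbf{I}\,a$, is an extensional $\mathbf{BI}(\_)^\bullet$-algebra.
   Context: Applicative structure: a set with a binary application written by juxtaposition, left associative; $a\circ b:=\mathbf{B}\,a\,b$. An extensional $\mathbf{BCI}$-algebra is an applicative structure with elements $\mathbf{B},\mathbf{C},\mathbf{I}$ such that for all $a,b,c$: $\mathbf{B}\,a\,b\,c=a\,(b\,c)$; $\mathbf{C}\,a\,b\,c=a\,c\,b$; $\mathbf{I}\,a=a$; $\mathbf{B}\,\mathbf{I}=\mathbf{I}$; $\mathbf{C}\,\mathbf{B}\,\mathbf{I}=\mathbf{I}$; $(\mathbf{B}\,\mathbf{B})\circ\mathbf{B}=(\mathbf{C}\,\mathbf{B}\,\mathbf{B})\circ(\mathbf{B}\circ\mathbf{B})$; $\mathbf{C}\circ\mathbf{C}=\mathbf{I}$; $(\mathbf{B}\,\mathbf{C})\circ(\mathbf{B}\circ\mathbf{B})=(\mathbf{C}\,\mathbf{B}\,\mathbf{C})\circ(\mathbf{B}\circ\mathbf{B})$; $(\mathbf{B}\,\mathbf{C})\circ(\mathbf{C}\circ(\mathbf{B}\,\mathbf{C}))=\mathbf{C}\circ((\mathbf{B}\,\mathbf{C})\circ\mathbf{C})$; $(\mathbf{B}\,\mathbf{B})\circ\mathbf{C}=\mathbf{C}\circ((\mathbf{B}\,\mathbf{C})\circ\mathbf{B})$. An extensional $\mathbf{BI}(\_)^\bullet$-algebra is an applicative structure with elements $\mathbf{B},\mathbf{I}$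 and a function $a\mapsto a^\bullet$ such that for all $a,b,c$: $\mathbf{I}\,a=a$; $\mathbf{B}\,a\,b\,c=a\,(b\,c)$; $a^\bullet\,b=b\,a$; $\mathbf{B}\,\mathbf{I}=\mathbf{I}$; $(a\,b)^\bullet=\mathbf{B}\,b^\bullet\,(\mathbf{B}\,a^\bullet\,\mathbf{B})$; $\mathbf{B}\,\mathbf{B}^\bullet\,(\mathbf{B}\,\mathbf{B}\,(\mathbf{B}\,\mathbf{B}\,\mathbf{B}))=\mathbf{B}\,(\mathbf{B}\,\mathbf{B})\,\mathbf{B}$; $\mathbf{B}\,\mathbf{I}^\bullet\,\mathbf{B}=\mathbf{I}$; $\mathbf{B}\,a^{\bullet\bullet}\,\mathbf{B}=\mathbf{B}\,(\mathbf{B}\,a^\bullet)\,\mathbf{B}$. -}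

module Defs where

open import Level using (Level; suc)
open import Relation.Binary.PropositionalEquality using (_≡_)

record IsExtBCI {a : Level} {A : Set a} (_·_ : A → A → A) (B C I : A) : Set a where
  _∘_ : A → A → A
  x ∘ y = (B · x) · y
  infixr 8 _∘_
  field
    B-ax : ∀ x y z → ((B · x) · y) · z ≡ x · (y · z)
    C-ax : ∀ x y z → ((C · x) · y) · z ≡ (x · z) · y
    I-ax : ∀ x → I · x ≡ x
    ext1 : B · I ≡ I
    ext2 : (C · B) · I ≡ I
    ext3 : (B · B) ∘ B ≡ ((C · B) · B) ∘ (B ∘ B)
    ext4 : C ∘ C ≡ I
    ext5 : (B · C) ∘ (B ∘ B) ≡ ((C · B) · C) ∘ (B ∘ B)
    ext6 : (B · C) ∘ (C ∘ (B · C)) ≡ C ∘ ((B · C) ∘ C)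
    ext7 : (B · B) ∘ C ≡ C ∘ ((B · C) ∘ B)

record IsExtBIBullet {a : Level} {A : Set a} (_·_ : A → A → A) (B I : A)
                     (_• : A → A) : Set a where
  field
    I-ax : ∀ x → I · x ≡ x
    B-ax : ∀ x y z → ((B · x) · y) · z ≡ x · (y · z)
    •-ax : ∀ x y → (x •) · y ≡ y · x
    ext1 : B · I ≡ I
    ext2 : ∀ x y → ((x · y) •) ≡ (B · (y •)) · ((B · (x •)) · B)
    ext3 : (B · (B •)) · ((B · B) · ((B · B) · B)) ≡ (B · (B · B)) · B
    ext4 : (B · (I •)) · B ≡ I
    ext5 : ∀ x → (B · ((x •) •)) · B ≡ (B · (B · (x •))) · B

record ExtBCIAlgebra (a : Level) : Set (suc a) where
  infixl 9 _·_
  field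
    Carrier : Set a
    _·_     : Carrier → Carrier → Carrier
    B C I   : Carrier
    isExtBCI : IsExtBCI _·_ B C I

-- Everything rests on the law x • ∘ r ≡ C · r · x, an instance of the
-- pointwise form (C · p · q) ∘ r ≡ C · (p ∘ r) · q of ext7.  It turns each
-- BI(_)•-axiom into an equation between C-terms, which the remaining
-- extensionality axioms of the BCI-algebra, applied to a variable, then close.
module Submission where

open import Level using (Level)
open import Relation.Binary.PropositionalEquality using (_≡_; sym; trans; cong; module ≡-Reasoning)
open import Defs

module ExtBCIAlgebraProperties {a : Level} (𝔸 : ExtBCIAlgebra a) where
  open ExtBCIAlgebra 𝔸
  open IsExtBCI isExtBCI
  open ≡-Reasoning

  infix 10 _•

  _• : Carrier → Carrier
  x • = C · I · x

  ∘-identityˡ : ∀ p → I ∘ p ≡ p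
  ∘-identityˡ p = trans (cong (_· p) ext1) (I-ax p)

  ∘-identityʳ : ∀ p → p ∘ I ≡ p
  ∘-identityʳ p = trans (sym (C-ax B I p)) (trans (cong (_· p) ext2) (I-ax p))

  C-involutive : ∀ p → C · (C · p) ≡ p
  C-involutive p = trans (sym (B-ax C C p)) (trans (cong (_· p) ext4) (I-ax p))

  B-distrib-∘ : ∀ p q → B · (p ∘ q) ≡ B · p ∘ B · q
  B-distrib-∘ p q = begin
      B · (p ∘ q)                ≡⟨ sym (B-ax B (B · p) q) ⟩
      (B ∘ B · p) · q            ≡⟨ cong (_· q) ext3-pointwise ⟩
      (B · (B · p) ∘ B) · q      ≡⟨ B-ax (B · (B · p)) B q ⟩
      B · p ∘ B · q              ∎
    where
    ext3-pointwise : B ∘ B · p ≡ B · (B · p) ∘ B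
    ext3-pointwise = begin
      B ∘ B · p                            ≡⟨ sym (B-ax (B · B) B p) ⟩
      (B · B ∘ B) · p                      ≡⟨ cong (_· p) ext3 ⟩
      (C · B · B ∘ B ∘ B) · p              ≡⟨ B-ax (C · B · B) (B ∘ B) p ⟩
      C · B · B · ((B ∘ B) · p)            ≡⟨ C-ax B B ((B ∘ B) · p) ⟩
      B · ((B ∘ B) · p) · B                ≡⟨ cong (λ h → B · h · B) (B-ax B B p) ⟩
      B · (B · (B · p)) · B                ∎

  ∘-assoc : ∀ p q r → (p ∘ q) ∘ r ≡ p ∘ q ∘ r
  ∘-assoc p q r = trans (cong (_· r) (B-distrib-∘ p q)) (B-ax (B · p) (B · q) r)

  ext7-pointwise : ∀ p → B ∘ C · p ≡ C · (C ∘ B · p)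
  ext7-pointwise p = begin
    B ∘ C · p                  ≡⟨ sym (B-ax (B · B) C p) ⟩
    (B · B ∘ C) · p            ≡⟨ cong (_· p) ext7 ⟩
    (C ∘ B · C ∘ B) · p        ≡⟨ B-ax C (B · C ∘ B) p ⟩
    C · ((B · C ∘ B) · p)      ≡⟨ cong (C ·_) (B-ax (B · C) B p) ⟩
    C · (C ∘ B · p)            ∎

  B-C : ∀ p q → B · (C · p · q) ≡ C · (C ∘ B · p) · q
  B-C p q = trans (sym (B-ax B (C · p) q)) (cong (_· q) (ext7-pointwise p))

  C-∘ : ∀ p q r → C · p · q ∘ r ≡ C · (p ∘ r) · q
  C-∘ p q r = begin
    C · p · q ∘ r                  ≡⟨ cong (_· r) (B-C p q) ⟩
    C · (C ∘ B · p) · q · r        ≡⟨ C-ax (C ∘ B · p) q r ⟩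
    (C ∘ B · p) · r · q            ≡⟨ cong (_· q) (B-ax C (B · p) r) ⟩
    C · (p ∘ r) · q                ∎

  C-B∘ : ∀ p q r → C · (B · p ∘ q) · r ≡ p ∘ C · q · r
  C-B∘ p q r = begin
      C · (B · p ∘ q) · r                ≡⟨ cong (_· r) (sym (B-ax C (B · (B · p)) q)) ⟩
      (C ∘ B · (B · p)) · q · r          ≡⟨ cong (λ h → h · q · r) ext5-pointwise ⟩
      (B · (B · p) ∘ C) · q · r          ≡⟨ cong (_· r) (B-ax (B · (B · p)) C q) ⟩
      (B · p ∘ C · q) · r                ≡⟨ B-ax (B · p) (C · q) r ⟩
      p ∘ C · q · r                      ∎
    where
    ext5-pointwise : C ∘ B · (B · p) ≡ B · (B · p) ∘ C
    ext5-pointwise = begin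
      C ∘ B · (B · p)                    ≡⟨ cong (C ∘_) (sym (B-ax B B p)) ⟩
      C ∘ (B ∘ B) · p                    ≡⟨ sym (B-ax (B · C) (B ∘ B) p) ⟩
      (B · C ∘ B ∘ B) · p                ≡⟨ cong (_· p) ext5 ⟩
      (C · B · C ∘ B ∘ B) · p            ≡⟨ B-ax (C · B · C) (B ∘ B) p ⟩
      C · B · C · ((B ∘ B) · p)          ≡⟨ C-ax B C ((B ∘ B) · p) ⟩
      B · ((B ∘ B) · p) · C              ≡⟨ cong (λ h → B · h · C) (B-ax B B p) ⟩
      B · (B · p) ∘ C                    ∎

  ∘-as-C : ∀ p q → p ∘ q ≡ C · (C · (B ∘ C · p) · q)
  ∘-as-C p q = begin
    p ∘ q                              ≡⟨ sym (C-involutive (p ∘ q)) ⟩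
    C · (C · (p ∘ q))                  ≡⟨ cong (C ·_) (sym (B-ax C (B · p) q)) ⟩
    C · ((C ∘ B · p) · q)              ≡⟨ cong (λ h → C · (h · q)) (sym (C-involutive (C ∘ B · p))) ⟩
    C · (C · (C · (C ∘ B · p)) · q)    ≡⟨ cong (λ h → C · (C · h · q)) (sym (ext7-pointwise p)) ⟩
    C · (C · (B ∘ C · p) · q)          ∎

  CI-∘ : ∀ q → C · I ∘ q ≡ C · (C · B · q)
  CI-∘ q = begin
    C · I ∘ q                          ≡⟨ ∘-as-C (C · I) q ⟩
    C · (C · (B ∘ C · (C · I)) · q)    ≡⟨ cong (λ h → C · (C · (B ∘ h) · q)) (C-involutive I) ⟩
    C · (C · (B ∘ I) · q)              ≡⟨ cong (λ h → C · (C · h · q)) (∘-identityʳ B) ⟩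
    C · (C · B · q)                    ∎

  •-app : ∀ x y → x • · y ≡ y · x
  •-app x y = trans (C-ax I x y) (cong (_· x) (I-ax y))

  •-∘ : ∀ x r → x • ∘ r ≡ C · r · x
  •-∘ x r = trans (C-∘ I x r) (cong (λ h → C · h · x) (∘-identityˡ r))

  B-• : ∀ x → B · x • ≡ C · C · x
  B-• x = begin
    B · x •                  ≡⟨ B-C I x ⟩
    C · (C ∘ B · I) · x      ≡⟨ cong (λ h → C · (C ∘ h) · x) ext1 ⟩
    C · (C ∘ I) · x          ≡⟨ cong (λ h → C · h · x) (∘-identityʳ C) ⟩
    C · C · x                ∎

  C∘B-expand : C · (B ∘ B) · (C · I) ≡ C ∘ B
  C∘B-expand = begin
    C · (B ∘ B) · (C · I)            ≡⟨ cong (λ h → C · h · (C · I)) (sym (∘-identityˡ (B ∘ B))) ⟩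
    C · (I ∘ B ∘ B) · (C · I)        ≡⟨ sym (C-∘ I (C · I) (B ∘ B)) ⟩
    C · I · (C · I) ∘ B ∘ B          ≡⟨ cong (_∘ B ∘ B) (sym (B-ax (C · I) C I)) ⟩
    (C · I ∘ C) · I ∘ B ∘ B          ≡⟨ cong (λ h → h · I ∘ B ∘ B) (CI-∘ C) ⟩
    C · (C · B · C) · I ∘ B ∘ B      ≡⟨ C-∘ (C · B · C) I (B ∘ B) ⟩
    C · (C · B · C ∘ B ∘ B) · I      ≡⟨ cong (λ h → C · h · I) (sym ext5) ⟩
    C · (B · C ∘ B ∘ B) · I          ≡⟨ C-B∘ C (B ∘ B) I ⟩
    C ∘ C · (B ∘ B) · I              ≡⟨ cong (C ∘_) (sym (C-∘ B I B)) ⟩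
    C ∘ C · B · I ∘ B                ≡⟨ cong (λ h → C ∘ h ∘ B) ext2 ⟩
    C ∘ I ∘ B                        ≡⟨ cong (C ∘_) (∘-identityˡ B) ⟩
    C ∘ B                            ∎

  [x·y]•≡y•∘[x•∘B] : ∀ x y → (x · y) • ≡ y • ∘ x • ∘ B
  [x·y]•≡y•∘[x•∘B] x y = begin
    (x · y) •                ≡⟨ sym (B-ax (C · I) x y) ⟩
    (C · I ∘ x) · y          ≡⟨ cong (_· y) (CI-∘ x) ⟩
    C · (C · B · x) · y      ≡⟨ cong (λ h → C · h · y) (sym (•-∘ x B)) ⟩
    C · (x • ∘ B) · y        ≡⟨ sym (•-∘ y (x • ∘ B)) ⟩
    y • ∘ x • ∘ B            ∎

  B•∘B∘B∘B≡B·B∘B : B • ∘ B ∘ B ∘ B ≡ B · B ∘ B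
  B•∘B∘B∘B≡B·B∘B = begin
    B • ∘ B ∘ B ∘ B          ≡⟨ sym (∘-assoc (B •) B (B ∘ B)) ⟩
    (B • ∘ B) ∘ B ∘ B        ≡⟨ cong (_∘ B ∘ B) (•-∘ B B) ⟩
    C · B · B ∘ B ∘ B        ≡⟨ sym ext3 ⟩
    B · B ∘ B                ∎

  I•∘B≡I : I • ∘ B ≡ I
  I•∘B≡I = trans (•-∘ I B) ext2

  x••∘B≡B·x•∘B : ∀ x → x • • ∘ B ≡ B · x • ∘ B
  x••∘B≡B·x•∘B x = begin
    x • • ∘ B                        ≡⟨ cong (_∘ B) (sym (B-ax (C · I) (C · I) x)) ⟩
    (C · I ∘ C · I) · x ∘ B          ≡⟨ cong (λ h → h · x ∘ B) (CI-∘ (C · I)) ⟩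
    C · (C · B · (C · I)) · x ∘ B    ≡⟨ C-∘ (C · B · (C · I)) x B ⟩
    C · (C · B · (C · I) ∘ B) · x    ≡⟨ cong (λ h → C · h · x) (C-∘ B (C · I) B) ⟩
    C · (C · (B ∘ B) · (C · I)) · x  ≡⟨ cong (λ h → C · h · x) C∘B-expand ⟩
    C · (C ∘ B) · x                  ≡⟨ sym (C-∘ C x B) ⟩
    C · C · x ∘ B                    ≡⟨ cong (_∘ B) (sym (B-• x)) ⟩
    B · x • ∘ B                      ∎

  isExtBIBullet : IsExtBIBullet _·_ B I _•
  isExtBIBullet = record
    { I-ax = I-ax
    ; B-ax = B-ax
    ; •-ax = •-app
    ; ext1 = ext1
    ; ext2 = [x·y]•≡y•∘[x•∘B]
    ; ext3 = B•∘B∘B∘B≡B·B∘B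
    ; ext4 = I•∘B≡I
    ; ext5 = x••∘B≡B·x•∘B
    }

lemma5p1 : ∀ {a : Level} (𝔸 : ExtBCIAlgebra a) →
    IsExtBIBullet (ExtBCIAlgebra._·_ 𝔸) (ExtBCIAlgebra.B 𝔸) (ExtBCIAlgebra.I 𝔸)
      (λ x → ExtBCIAlgebra._·_ 𝔸 (ExtBCIAlgebra._·_ 𝔸 (ExtBCIAlgebra.C 𝔸) (ExtBCIAlgebra.I 𝔸)) x)
lemma5p1 𝔸 = ExtBCIAlgebraProperties.isExtBIBullet 𝔸
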